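{- Let $\mathcal{F}\subseteq 2^{[n]}$ be an s-extremal family. Then there exist a unique Sperner family $\mathcal{S}\subseteq 2^{[n]}$ and a unique function $h:\mathcal{S}\to 2^{[n]}$ with $h(S)\subseteq S$ for every $S\in\mathcal{S}$ such that $\mathcal{F}=\mathcal{F}(\mathcal{S},h)$ and $\mathrm{Sh}(\mathcal{F})=\mathcal{H}(\mathcal{S})$.
   Context: $[n]=\{1,\dots,n\}$. A family $\mathcal{F}\subseteq 2^{[n]}$ shatters $S\subseteq[n]$ if $\{F\cap S: F\in\mathcal{F}\}=2^S$; $\mathrm{Sh}(\mathcal{F})$ is the family of sets shattered by $\mathcal{F}$. $\mathcal{F}$ is s-extremal if $|\mathrm{Sh}(\mathcal{F})|=|\mathcal{F}|$. A Sperner family is a family none of whose members contains another. For $H\subseteq S\subseteq[n]$ let $\mathcal{P}_S=\{S\cup B: B\subseteq [n]\setminus S\}$ and $\mathcal{Q}_{S,H}=\{H\cup B: B\subseteq[n]\setminus S\}$. Define $\mathcal{H}(\mathcal{S})=2^{[n]}\setminus\bigcup_{S\in\mathcal{S}}\mathcal{P}_S$ and $\mathcal{F}(\mathcal{S},h)=2^{[n]}\setminus\bigcup_{S\in\mathcal{S}}\mathcal{Q}_{S,h(S)}$. -}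

module Defs where

open import Data.Nat using (ℕ; zero; suc)
open import Data.Bool using (Bool; true; false; not; _∧_)
open import Data.Bool.Properties using () renaming (_≟_ to _≟ᵇ_)
open import Data.Vec using (Vec; []; _∷_)
open import Data.Vec.Properties using (≡-dec)
open import Data.List using (List; []; _∷_; _++_; map; length; filterᵇ)
open import Data.Bool.ListAction using (any; all)
open import Data.Fin.Subset using (Subset; inside; outside; _∩_; _⊆_)
open import Data.Fin.Subset.Properties using (_⊆?_)
open import Data.Product using (Σ; _×_)
open import Relation.Nullary using (¬_)
open import Relation.Nullary.Decidable using (⌊_⌋)
open import Relation.Binary.PropositionalEquality using (_≡_)

Family : ℕ → Set
Family n = Subset n → Bool

_∈F_ : ∀ {n} → Subset n → Family n → Set
A ∈F F = F A ≡ true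

_≐_ : ∀ {n} → Family n → Family n → Set
F ≐ G = ∀ A → F A ≡ G A

-- enumeration of all 2^n subsets of [n] (each exactly once)
allSubsets : (n : ℕ) → List (Subset n)
allSubsets zero    = [] ∷ []
allSubsets (suc n) = map (outside ∷_) (allSubsets n) ++ map (inside ∷_) (allSubsets n)

card : ∀ {n} → Family n → ℕ
card {n} F = length (filterᵇ F (allSubsets n))

_==_ : ∀ {n} → Subset n → Subset n → Bool
A == B = ⌊ ≡-dec _≟ᵇ_ A B ⌋

_⊆ᵇ_ : ∀ {n} → Subset n → Subset n → Bool
A ⊆ᵇ B = ⌊ A ⊆? B ⌋

shatters : ∀ {n} → Family n → Subset n → Bool
shatters {n} F S =
  all (λ T → not (T ⊆ᵇ S) Data.Bool.∨ any (λ A → F A ∧ ((A ∩ S) == T)) (allSubsets n))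
      (allSubsets n)

Sh : ∀ {n} → Family n → Family n
Sh F = shatters F

sExtremal : ∀ {n} → Family n → Set
sExtremal F = card (Sh F) ≡ card F

Sperner : ∀ {n} → Family n → Set
Sperner 𝒮 = ∀ A B → A ∈F 𝒮 → B ∈F 𝒮 → A ⊆ B → A ≡ B

inP : ∀ {n} → Subset n → Subset n → Bool
inP S A = S ⊆ᵇ A

-- A ∈ Q_{S,H}  iff  A ∩ S = H   (for H ⊆ S, A = H ∪ B with B ⊆ [n]∖S)
inQ : ∀ {n} → Subset n → Subset n → Subset n → Bool
inQ S H A = (A ∩ S) == H

𝓗 : ∀ {n} → Family n → Family n
𝓗 {n} 𝒮 A = not (any (λ S → 𝒮 S ∧ inP S A) (allSubsets n))

𝓕 : ∀ {n} → Family n → (Subset n → Subset n) → Family n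
𝓕 {n} 𝒮 h A = not (any (λ S → 𝒮 S ∧ inQ S (h S) A) (allSubsets n))

-- (𝒮, h) is a representation of F as in the lemma
-- (h only matters on members of 𝒮; it is a function 𝒮 → 2^[n])
Represents : ∀ {n} → Family n → Family n → (Subset n → Subset n) → Set
Represents F 𝒮 h =
  Sperner 𝒮 × (∀ S → S ∈F 𝒮 → h S ⊆ S) × (F ≐ 𝓕 𝒮 h) × (Sh F ≐ 𝓗 𝒮)

module Submission where

-- Call S critical for F when F does not shatter S but shatters every proper
-- subset of S.  The representation is forced: 𝒮 must be the family of
-- critical sets (Sh F is closed under subsets and 𝓗(𝒮) consists of the sets
-- containing no member of 𝒮), and h(S) must be a trace on S missing from F.
-- Existence and uniqueness thus reduce to two facts about s-extremal F:
--   (1) a critical set misses exactly one trace ('missing-unique');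
--   (2) F equals 𝓕(𝒮₀,h₀) for the canonical choice, not merely lies in it.
-- Both rest on Pajor's inequality |F| ≤ |Sh F|, proved by splitting [n+1] at
-- its first point.  For s-extremal F every step of that proof is tight, so
-- the two slices F₀, F₁ and the projection F₀ ∪ F₁ are s-extremal and
-- Sh(F₀ ∪ F₁) = Sh F₀ ∪ Sh F₁; (1) follows by induction on n and (2) by
-- counting |𝓕| ≤ |Sh 𝓕| ≤ |Sh F| = |F|.

open import Defs
open import Data.Nat using (ℕ; zero; suc; _+_; _≤_; z≤n; s≤s; s≤s⁻¹)
open import Data.Nat.Properties
  using (≤-trans; ≤-antisym; ≤-reflexive; +-mono-≤; +-monoˡ-≤; +-monoʳ-≤; +-cancelˡ-≤;
         +-cancelʳ-≤; +-suc; m≤n⇒m≤1+n; <⇒≱; module ≤-Reasoning)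
open import Data.Bool using (Bool; true; false; _∧_; _∨_; T?)
open import Data.Bool.Properties using (_≟_; ∧-identityʳ)
open import Data.Bool.ListAction using (any; all)
open import Data.List using (List; []; _∷_; _++_; map; length; filterᵇ)
open import Data.List.Properties using (length-++; filter-++)
open import Data.List.Membership.Propositional using (lose) renaming (_∈_ to _∈ₗ_)
open import Data.List.Membership.Propositional.Properties using (∈-map⁺; ∈-++⁺ˡ; ∈-++⁺ʳ)
import Data.List.Relation.Unary.Any as Any
import Data.List.Relation.Unary.All as All
open import Data.Vec using ([]; _∷_)
open import Data.Vec.Base using (here)
open import Data.Vec.Properties using (≡-dec; ∷-injectiveˡ; ∷-injectiveʳ)
open import Data.Fin.Subset using (Subset; inside; outside; _∩_; _⊆_; _⊂_)
open import Data.Fin.Subset.Properties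
  using (_∈?_; _⊆?_; _⊂?_; ⊆-refl; ⊆-trans; ⊆-antisym; drop-∷-⊆; out⊆; in⊆in; s⊂s; out⊂in;
         ⊂-⊆-trans; ⊂-irref; p∩q⊆p; x∈p∩q⁺; ∩-assoc; ∩-comm; anySubset?)
open import Data.Fin.Subset.Induction using (⊂-wellFounded)
open import Induction.WellFounded using (Acc; acc)
open import Data.Product using (Σ; ∃; _×_; _,_; proj₁; proj₂)
open import Data.Sum using (_⊎_; inj₁; inj₂; [_,_]′) renaming (map to ⊎-map)
open import Data.Empty using (⊥; ⊥-elim)
open import Function using (_∘_; _⇔_; mk⇔; Equivalence)
open import Relation.Nullary using (¬_; Dec; yes; no; _because_; does; proof; contradiction; ¬?)
open import Relation.Nullary.Decidable using (⌊_⌋; decidable-stable; _×-dec_; map′)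
open import Relation.Nullary.Reflects
  using (Reflects; ofʸ; ofⁿ; det; _×-reflects_; _⊎-reflects_; _→-reflects_; ¬-reflects)
open import Relation.Binary.PropositionalEquality
  using (_≡_; refl; sym; trans; cong; cong₂; subst; module ≡-Reasoning)

reflects-map : ∀ {P Q : Set} {b} → (P → Q) → (Q → P) → Reflects P b → Reflects Q b
reflects-map f g (ofʸ p)  = ofʸ (f p)
reflects-map f g (ofⁿ ¬p) = ofⁿ (¬p ∘ g)

reflects-sound : ∀ {P : Set} {b} → Reflects P b → b ≡ true → P
reflects-sound (ofʸ p) _ = p

reflects-complete : ∀ {P : Set} {b} → Reflects P b → P → b ≡ true
reflects-complete (ofʸ _)  _ = refl
reflects-complete (ofⁿ ¬p) p = contradiction p ¬p

reflects-equal : ∀ {P Q : Set} {b c} → Reflects P b → Reflects Q c → (P → Q) → (Q → P) → b ≡ c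
reflects-equal rP rQ f g = det (reflects-map f g rP) rQ

reflects-⇔ : ∀ {P Q : Set} {b} → Reflects P b → Reflects Q b → P ⇔ Q
reflects-⇔ rP rQ = mk⇔ (reflects-sound rQ ∘ reflects-complete rP)
                       (reflects-sound rP ∘ reflects-complete rQ)

isTrue-reflects : ∀ b → Reflects (b ≡ true) b
isTrue-reflects true  = ofʸ refl
isTrue-reflects false = ofⁿ λ ()

isYes-reflects : ∀ {P : Set} (d : Dec P) → Reflects P ⌊ d ⌋
isYes-reflects (yes p) = ofʸ p
isYes-reflects (no ¬p) = ofⁿ ¬p

allSubsets-complete : ∀ {n} (A : Subset n) → A ∈ₗ allSubsets n
allSubsets-complete []                  = Any.here refl
allSubsets-complete {suc n} (outside ∷ A) = ∈-++⁺ˡ (∈-map⁺ (outside ∷_) (allSubsets-complete A))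
allSubsets-complete {suc n} (inside ∷ A)  =
  ∈-++⁺ʳ (map (outside ∷_) (allSubsets n)) (∈-map⁺ (inside ∷_) (allSubsets-complete A))

module _ {A : Set} {P : A → Set} {p : A → Bool} (r : ∀ x → Reflects (P x) (p x)) where

  anyList-reflects : ∀ xs → Reflects (Any.Any P xs) (any p xs)
  anyList-reflects []       = ofⁿ λ ()
  anyList-reflects (x ∷ xs) = reflects-map Any.fromSum Any.toSum (r x ⊎-reflects anyList-reflects xs)

  allList-reflects : ∀ xs → Reflects (All.All P xs) (all p xs)
  allList-reflects []       = ofʸ All.[]
  allList-reflects (x ∷ xs) =
    reflects-map (λ (px , pxs) → px All.∷ pxs) All.uncons (r x ×-reflects allList-reflects xs)

module _ {n} {P : Subset n → Set} {p : Subset n → Bool} (r : ∀ A → Reflects (P A) (p A)) where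

  any-reflects : Reflects (∃ P) (any p (allSubsets n))
  any-reflects = reflects-map Any.satisfied (λ (A , pA) → lose (allSubsets-complete A) pA)
                              (anyList-reflects r (allSubsets n))

  all-reflects : Reflects (∀ A → P A) (all p (allSubsets n))
  all-reflects = reflects-map (λ ps A → All.lookup ps (allSubsets-complete A))
                              (λ ps → All.tabulate λ {A} _ → ps A)
                              (allList-reflects r (allSubsets n))

==-reflects : ∀ {n} (A B : Subset n) → Reflects (A ≡ B) (A == B)
==-reflects A B = isYes-reflects (≡-dec _≟_ A B)

⊆ᵇ-reflects : ∀ {n} (A B : Subset n) → Reflects (A ⊆ B) (A ⊆ᵇ B)
⊆ᵇ-reflects A B = isYes-reflects (A ⊆? B)

∩-absorb : ∀ {n} {T R : Subset n} → T ⊆ R → T ∩ R ≡ T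
∩-absorb {T = T} {R} T⊆R = ⊆-antisym (p∩q⊆p T R) (λ x∈T → x∈p∩q⁺ (x∈T , T⊆R x∈T))

∩-restrict : ∀ {n} (A : Subset n) {R S : Subset n} → R ⊆ S → (A ∩ S) ∩ R ≡ A ∩ R
∩-restrict A {R} {S} R⊆S = trans (∩-assoc A S R) (cong (A ∩_) (trans (∩-comm S R) (∩-absorb R⊆S)))

⊆∧⊄⇒≡ : ∀ {n} {A B : Subset n} → A ⊆ B → ¬ A ⊂ B → A ≡ B
⊆∧⊄⇒≡ {A = A} A⊆B A⊄B = ⊆-antisym A⊆B λ {x} x∈B →
  decidable-stable (x ∈? A) (λ x∉A → A⊄B (A⊆B , x , x∈B , x∉A))

⊆outside-head : ∀ {n} {t} {T S : Subset n} → t ∷ T ⊆ outside ∷ S → t ≡ outside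
⊆outside-head {t = outside} _   = refl
⊆outside-head {t = inside}  T⊆S with () ← T⊆S here

∷⊆inside∷ : ∀ {n} b {T S : Subset n} → T ⊆ S → b ∷ T ⊆ inside ∷ S
∷⊆inside∷ outside = out⊆
∷⊆inside∷ inside  = in⊆in

_⊆F_ : ∀ {n} → Family n → Family n → Set
F ⊆F G = ∀ A → A ∈F F → A ∈F G

_∪F_ _∩F_ : ∀ {n} → Family n → Family n → Family n
(F ∪F G) A = F A ∨ G A
(F ∩F G) A = F A ∧ G A

slice : ∀ {n} → Bool → Family (suc n) → Family n
slice b F A = F (b ∷ A)

∈∪F : ∀ {n} (F G : Family n) A → A ∈F (F ∪F G) ⇔ (A ∈F F ⊎ A ∈F G)
∈∪F F G A = reflects-⇔ (isTrue-reflects _) (isTrue-reflects (F A) ⊎-reflects isTrue-reflects (G A))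

∈∩F : ∀ {n} (F G : Family n) A → A ∈F (F ∩F G) ⇔ (A ∈F F × A ∈F G)
∈∩F F G A = reflects-⇔ (isTrue-reflects _) (isTrue-reflects (F A) ×-reflects isTrue-reflects (G A))

⊆∪Fˡ : ∀ {n} (F G : Family n) → F ⊆F (F ∪F G)
⊆∪Fˡ F G A A∈F = Equivalence.from (∈∪F F G A) (inj₁ A∈F)

⊆∪Fʳ : ∀ {n} (F G : Family n) → G ⊆F (F ∪F G)
⊆∪Fʳ F G A A∈G = Equivalence.from (∈∪F F G A) (inj₂ A∈G)

∩F⊆ˡ : ∀ {n} (F G : Family n) → (F ∩F G) ⊆F F
∩F⊆ˡ F G A A∈F∩G = proj₁ (Equivalence.to (∈∩F F G A) A∈F∩G)

∩F⊆ʳ : ∀ {n} (F G : Family n) → (F ∩F G) ⊆F G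
∩F⊆ʳ F G A A∈F∩G = proj₂ (Equivalence.to (∈∩F F G A) A∈F∩G)

⊆F-antisym : ∀ {n} {F G : Family n} → F ⊆F G → G ⊆F F → F ≐ G
⊆F-antisym {F = F} {G} F⊆G G⊆F A =
  reflects-equal (isTrue-reflects (F A)) (isTrue-reflects (G A)) (F⊆G A) (G⊆F A)

count : ∀ {A : Set} → (A → Bool) → List A → ℕ
count p xs = length (filterᵇ p xs)

module _ {A : Set} where

  count-++ : ∀ (p : A → Bool) xs ys → count p (xs ++ ys) ≡ count p xs + count p ys
  count-++ p xs ys = trans (cong length (filter-++ (T? ∘ p) xs ys)) (length-++ (filterᵇ p xs))

  count-map : ∀ {B : Set} (p : B → Bool) (f : A → B) xs → count p (map f xs) ≡ count (p ∘ f) xs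
  count-map p f []       = refl
  count-map p f (x ∷ xs) with p (f x)
  ... | true  = cong suc (count-map p f xs)
  ... | false = count-map p f xs

  count-mono : ∀ (p q : A → Bool) → (∀ x → p x ≡ true → q x ≡ true) →
               ∀ xs → count p xs ≤ count q xs
  count-mono p q p⇒q []       = z≤n
  count-mono p q p⇒q (x ∷ xs) with p x in px | q x in qx
  ... | true  | true  = s≤s (count-mono p q p⇒q xs)
  ... | true  | false with () ← trans (sym (p⇒q x px)) qx
  ... | false | true  = m≤n⇒m≤1+n (count-mono p q p⇒q xs)
  ... | false | false = count-mono p q p⇒q xs

  count-∨∧ : ∀ (p q : A → Bool) xs →
             count (λ x → p x ∨ q x) xs + count (λ x → p x ∧ q x) xs ≡ count p xs + count q xs
  count-∨∧ p q [] = refl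
  count-∨∧ p q (x ∷ xs) with p x | q x
  ... | true  | true  = cong suc (trans (+-suc _ _)
                         (trans (cong suc (count-∨∧ p q xs)) (sym (+-suc _ _))))
  ... | true  | false = cong suc (count-∨∧ p q xs)
  ... | false | true  = trans (cong suc (count-∨∧ p q xs)) (sym (+-suc _ _))
  ... | false | false = count-∨∧ p q xs

  count-squeeze : ∀ (p q : A → Bool) → (∀ x → p x ≡ true → q x ≡ true) → ∀ xs →
                  count q xs ≤ count p xs → All.All (λ x → q x ≡ true → p x ≡ true) xs
  count-squeeze p q p⇒q []       _ = All.[]
  count-squeeze p q p⇒q (x ∷ xs) q≤p with p x in px | q x in qx
  ... | true  | true  = (λ _ → px) All.∷ count-squeeze p q p⇒q xs (s≤s⁻¹ q≤p)
  ... | true  | false with () ← trans (sym (p⇒q x px)) qx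
  ... | false | true  with () ← <⇒≱ (s≤s (count-mono p q p⇒q xs)) q≤p
  ... | false | false = (λ q≡true → contradiction (trans (sym q≡true) qx) λ ()) All.∷
                        count-squeeze p q p⇒q xs q≤p

card-mono : ∀ {n} {F G : Family n} → F ⊆F G → card F ≤ card G
card-mono {n} {F} {G} F⊆G = count-mono F G F⊆G (allSubsets n)

card-cong : ∀ {n} {F G : Family n} → F ≐ G → card F ≡ card G
card-cong F≐G = ≤-antisym (card-mono λ A A∈F → trans (sym (F≐G A)) A∈F)
                          (card-mono λ A A∈G → trans (F≐G A) A∈G)

card-squeeze : ∀ {n} {F G : Family n} → F ⊆F G → card G ≤ card F → G ⊆F F
card-squeeze {n} {F} {G} F⊆G G≤F A =
  All.lookup (count-squeeze F G F⊆G (allSubsets n) G≤F) (allSubsets-complete A)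

card-∪∩ : ∀ {n} (F G : Family n) → card (F ∪F G) + card (F ∩F G) ≡ card F + card G
card-∪∩ {n} F G = count-∨∧ F G (allSubsets n)

card-slices : ∀ {n} (F : Family (suc n)) → card F ≡ card (slice outside F) + card (slice inside F)
card-slices {n} F = trans (count-++ F (map (outside ∷_) L) (map (inside ∷_) L))
                          (cong₂ _+_ (count-map F (outside ∷_) L) (count-map F (inside ∷_) L))
  where
  L : List (Subset n)
  L = allSubsets n

Occurs : ∀ {n} → Family n → Subset n → Subset n → Set
Occurs {n} F S T = ∃ λ (A : Subset n) → A ∈F F × A ∩ S ≡ T

Shatters : ∀ {n} → Family n → Subset n → Set
Shatters F S = ∀ T → T ⊆ S → Occurs F S T

occurs-reflects : ∀ {n} (F : Family n) S T →
                  Reflects (Occurs F S T) (any (λ A → F A ∧ inQ S T A) (allSubsets n))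
occurs-reflects F S T = any-reflects λ A → isTrue-reflects (F A) ×-reflects ==-reflects (A ∩ S) T

occurs? : ∀ {n} (F : Family n) S T → Dec (Occurs F S T)
occurs? F S T = _ because occurs-reflects F S T

Sh-reflects : ∀ {n} (F : Family n) S → Reflects (Shatters F S) (Sh F S)
Sh-reflects F S = all-reflects λ T → ⊆ᵇ-reflects T S →-reflects occurs-reflects F S T

shatters? : ∀ {n} (F : Family n) S → Dec (Shatters F S)
shatters? F S = Sh F S because Sh-reflects F S

InUnionP : ∀ {n} → Family n → Subset n → Set
InUnionP {n} 𝒮 A = ∃ λ (S : Subset n) → S ∈F 𝒮 × S ⊆ A

InUnionQ : ∀ {n} → Family n → (Subset n → Subset n) → Subset n → Set
InUnionQ {n} 𝒮 h A = ∃ λ (S : Subset n) → S ∈F 𝒮 × A ∩ S ≡ h S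

inUnionP? : ∀ {n} (𝒮 : Family n) A → Dec (InUnionP 𝒮 A)
inUnionP? 𝒮 A = _ because any-reflects λ S → isTrue-reflects (𝒮 S) ×-reflects ⊆ᵇ-reflects S A

𝓗-reflects : ∀ {n} (𝒮 : Family n) A → Reflects (¬ InUnionP 𝒮 A) (𝓗 𝒮 A)
𝓗-reflects 𝒮 A = ¬-reflects (proof (inUnionP? 𝒮 A))

𝓕-reflects : ∀ {n} (𝒮 : Family n) h A → Reflects (¬ InUnionQ 𝒮 h A) (𝓕 𝒮 h A)
𝓕-reflects 𝒮 h A =
  ¬-reflects (any-reflects λ S → isTrue-reflects (𝒮 S) ×-reflects ==-reflects (A ∩ S) (h S))

shatters-mono : ∀ {n} {F G : Family n} {S} → F ⊆F G → Shatters F S → Shatters G S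
shatters-mono F⊆G sh T T⊆S with sh T T⊆S
... | A , A∈F , A∩S≡T = A , F⊆G A A∈F , A∩S≡T

Sh-mono : ∀ {n} {F G : Family n} → F ⊆F G → Sh F ⊆F Sh G
Sh-mono {F = F} {G} F⊆G S =
  reflects-complete (Sh-reflects G S) ∘ shatters-mono F⊆G ∘ reflects-sound (Sh-reflects F S)

shatters-down : ∀ {n} {F : Family n} {R S} → R ⊆ S → Shatters F S → Shatters F R
shatters-down {R = R} {S} R⊆S sh T T⊆R with sh T (⊆-trans T⊆R R⊆S)
... | A , A∈F , A∩S≡T = A , A∈F , A∩R≡T
  where
  open ≡-Reasoning
  A∩R≡T : A ∩ R ≡ T
  A∩R≡T = begin
    A ∩ R        ≡⟨ sym (∩-restrict A R⊆S) ⟩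
    (A ∩ S) ∩ R  ≡⟨ cong (_∩ R) A∩S≡T ⟩
    T ∩ R        ≡⟨ ∩-absorb T⊆R ⟩
    T            ∎

Minimal : ∀ {n} → Family n → Subset n → Set
Minimal F S = ∀ {R} → R ⊂ S → Shatters F R

Missing : ∀ {n} → Family n → Subset n → Subset n → Set
Missing F S T = T ⊆ S × ¬ Occurs F S T

unshattered⊆minimal : ∀ {n} {F : Family n} {R S} → Minimal F S → ¬ Shatters F R → R ⊆ S → R ≡ S
unshattered⊆minimal {R = R} {S} min ¬sh R⊆S with R ⊂? S
... | yes R⊂S = contradiction (min R⊂S) ¬sh
... | no  R⊄S = ⊆∧⊄⇒≡ R⊆S R⊄S

module FirstPoint {n} (F : Family (suc n)) where

  F₀ F₁ G : Family n
  F₀ = slice outside F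
  F₁ = slice inside F
  G  = F₀ ∪F F₁

  occurs-outside : ∀ {S T} → Occurs F (outside ∷ S) (outside ∷ T) ⇔ Occurs G S T
  occurs-outside = mk⇔ forget lift
    where
    forget : ∀ {S T} → Occurs F (outside ∷ S) (outside ∷ T) → Occurs G S T
    forget (outside ∷ A , A∈F , eq) = A , ⊆∪Fˡ F₀ F₁ A A∈F , ∷-injectiveʳ eq
    forget (inside  ∷ A , A∈F , eq) = A , ⊆∪Fʳ F₀ F₁ A A∈F , ∷-injectiveʳ eq
    lift : ∀ {S T} → Occurs G S T → Occurs F (outside ∷ S) (outside ∷ T)
    lift (A , A∈G , eq) with Equivalence.to (∈∪F F₀ F₁ A) A∈G
    ... | inj₁ A∈F₀ = outside ∷ A , A∈F₀ , cong (outside ∷_) eq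
    ... | inj₂ A∈F₁ = inside  ∷ A , A∈F₁ , cong (outside ∷_) eq

  occurs-inside : ∀ b {S T} → Occurs F (inside ∷ S) (b ∷ T) ⇔ Occurs (slice b F) S T
  occurs-inside b = mk⇔ forget lift
    where
    forget : ∀ {S T} → Occurs F (inside ∷ S) (b ∷ T) → Occurs (slice b F) S T
    forget (a ∷ A , A∈F , eq) with trans (sym (∧-identityʳ a)) (∷-injectiveˡ eq)
    ... | refl = A , A∈F , ∷-injectiveʳ eq
    lift : ∀ {S T} → Occurs (slice b F) S T → Occurs F (inside ∷ S) (b ∷ T)
    lift (A , A∈F , eq) = b ∷ A , A∈F , cong₂ _∷_ (∧-identityʳ b) eq

  shatters-outside : ∀ {S} → Shatters F (outside ∷ S) ⇔ Shatters G S
  shatters-outside = mk⇔ forget lift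
    where
    forget : ∀ {S} → Shatters F (outside ∷ S) → Shatters G S
    forget sh T T⊆S = Equivalence.to occurs-outside (sh (outside ∷ T) (out⊆ T⊆S))
    lift : ∀ {S} → Shatters G S → Shatters F (outside ∷ S)
    lift sh (t ∷ T) tT⊆ with refl ← ⊆outside-head tT⊆ =
      Equivalence.from occurs-outside (sh T (drop-∷-⊆ tT⊆))

  shatters-inside : ∀ {S} → Shatters F (inside ∷ S) ⇔ (∀ b → Shatters (slice b F) S)
  shatters-inside = mk⇔ forget lift
    where
    forget : ∀ {S} → Shatters F (inside ∷ S) → ∀ b → Shatters (slice b F) S
    forget sh b T T⊆S = Equivalence.to (occurs-inside b) (sh (b ∷ T) (∷⊆inside∷ b T⊆S))
    lift : ∀ {S} → (∀ b → Shatters (slice b F) S) → Shatters F (inside ∷ S)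
    lift sh (t ∷ T) tT⊆ = Equivalence.from (occurs-inside t) (sh t T (drop-∷-⊆ tT⊆))

  Sh-outside : ∀ S → Sh F (outside ∷ S) ≡ Sh G S
  Sh-outside S = reflects-equal (Sh-reflects F _) (Sh-reflects G S)
                   (Equivalence.to shatters-outside) (Equivalence.from shatters-outside)

  Sh-inside : ∀ S → Sh F (inside ∷ S) ≡ (Sh F₀ ∩F Sh F₁) S
  Sh-inside S = reflects-equal (Sh-reflects F _) (Sh-reflects F₀ S ×-reflects Sh-reflects F₁ S)
    (λ sh → Equivalence.to shatters-inside sh outside , Equivalence.to shatters-inside sh inside)
    (λ (sh₀ , sh₁) → Equivalence.from shatters-inside λ { outside → sh₀ ; inside → sh₁ })

  minimal-outside : ∀ {S} → Minimal F (outside ∷ S) → Minimal G S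
  minimal-outside min R⊂S = Equivalence.to shatters-outside (min (s⊂s R⊂S))

  minimal-inside : ∀ {S} → Minimal F (inside ∷ S) → ∀ b → Minimal (slice b F) S
  minimal-inside min b R⊂S = Equivalence.to shatters-inside (min (s⊂s R⊂S)) b

  missing-outside : ∀ {S T} → Missing F (outside ∷ S) (outside ∷ T) → Missing G S T
  missing-outside (T⊆S , ¬occ) = drop-∷-⊆ T⊆S , ¬occ ∘ Equivalence.from occurs-outside

  missing-inside : ∀ b {S T} → Missing F (inside ∷ S) (b ∷ T) → Missing (slice b F) S T
  missing-inside b (T⊆S , ¬occ) = drop-∷-⊆ T⊆S , ¬occ ∘ Equivalence.from (occurs-inside b)

  card-Sh : card (Sh F) ≡ card (Sh G) + card (Sh F₀ ∩F Sh F₁)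
  card-Sh = trans (card-slices (Sh F)) (cong₂ _+_ (card-cong Sh-outside) (card-cong Sh-inside))

  Sh-slices⊆Sh-G : (Sh F₀ ∪F Sh F₁) ⊆F Sh G
  Sh-slices⊆Sh-G S S∈ = [ Sh-mono (⊆∪Fˡ F₀ F₁) S , Sh-mono (⊆∪Fʳ F₀ F₁) S ]′
                           (Equivalence.to (∈∪F (Sh F₀) (Sh F₁) S) S∈)

pajor : ∀ {n} (F : Family n) → card F ≤ card (Sh F)
pajor {zero} F = card-mono {F = F} {Sh F} λ { [] []∈F →
  reflects-complete (Sh-reflects F []) λ { [] _ → [] , []∈F , refl } }
pajor {suc n} F = begin
  card F                                         ≡⟨ card-slices F ⟩
  card F₀ + card F₁                              ≤⟨ +-mono-≤ (pajor F₀) (pajor F₁) ⟩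
  card (Sh F₀) + card (Sh F₁)                    ≡⟨ sym (card-∪∩ (Sh F₀) (Sh F₁)) ⟩
  card (Sh F₀ ∪F Sh F₁) + card (Sh F₀ ∩F Sh F₁)  ≤⟨ +-monoˡ-≤ _ (card-mono Sh-slices⊆Sh-G) ⟩
  card (Sh G) + card (Sh F₀ ∩F Sh F₁)            ≡⟨ sym card-Sh ⟩
  card (Sh F)                                    ∎
  where
  open FirstPoint F
  open ≤-Reasoning

+-tight : ∀ {x y a b} → x ≤ a → y ≤ b → a + b ≤ x + y → x ≡ a × y ≡ b
+-tight {x} {y} {a} {b} x≤a y≤b ab≤xy =
  ≤-antisym x≤a (+-cancelʳ-≤ b a x (≤-trans ab≤xy (+-monoʳ-≤ x y≤b))) ,
  ≤-antisym y≤b (+-cancelˡ-≤ a b y (≤-trans ab≤xy (+-monoˡ-≤ y x≤a)))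

-- For an s-extremal F on [n+1] every inequality in Pajor's induction step is
-- an equality.  Hence both slices and the projection G are s-extremal, and
-- Sh G = Sh F₀ ∪ Sh F₁.

record ExtremalSlices {n} (F : Family (suc n)) : Set where
  field
    slice-extremal      : ∀ b → sExtremal (slice b F)
    projection-extremal : sExtremal (FirstPoint.G F)
    projection-shatters : ∀ {S} → Shatters (FirstPoint.G F) S →
                          Shatters (slice outside F) S ⊎ Shatters (slice inside F) S

extremal-slices : ∀ {n} (F : Family (suc n)) → sExtremal F → ExtremalSlices F
extremal-slices F ext = record
  { slice-extremal      = λ { outside → sym (proj₁ slices-tight)
                            ; inside  → sym (proj₂ slices-tight) }
  ; projection-extremal = sym (proj₁ projection-tight)
  ; projection-shatters = projection-shatters
  }
  where
  open FirstPoint F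
  open ≤-Reasoning

  shared : ℕ
  shared = card (Sh F₀ ∩F Sh F₁)

  Sh-split : card (Sh G) + shared ≡ card F₀ + card F₁
  Sh-split = trans (sym card-Sh) (trans ext (card-slices F))

  slices-tight : card F₀ ≡ card (Sh F₀) × card F₁ ≡ card (Sh F₁)
  slices-tight = +-tight (pajor F₀) (pajor F₁) (begin
    card (Sh F₀) + card (Sh F₁)  ≡⟨ sym (card-∪∩ (Sh F₀) (Sh F₁)) ⟩
    card (Sh F₀ ∪F Sh F₁) + shared  ≤⟨ +-monoˡ-≤ shared (card-mono Sh-slices⊆Sh-G) ⟩
    card (Sh G) + shared            ≡⟨ Sh-split ⟩
    card F₀ + card F₁               ∎)

  Sh-G≤Sh-slices : card (Sh G) ≤ card (Sh F₀ ∪F Sh F₁)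
  Sh-G≤Sh-slices = +-cancelʳ-≤ shared _ _ (begin
    card (Sh G) + shared            ≡⟨ Sh-split ⟩
    card F₀ + card F₁               ≤⟨ +-mono-≤ (pajor F₀) (pajor F₁) ⟩
    card (Sh F₀) + card (Sh F₁)     ≡⟨ sym (card-∪∩ (Sh F₀) (Sh F₁)) ⟩
    card (Sh F₀ ∪F Sh F₁) + shared  ∎)

  projection-shatters : ∀ {S} → Shatters G S → Shatters F₀ S ⊎ Shatters F₁ S
  projection-shatters {S} sh =
    ⊎-map (reflects-sound (Sh-reflects F₀ S)) (reflects-sound (Sh-reflects F₁ S))
      (Equivalence.to (∈∪F (Sh F₀) (Sh F₁) S)
        (card-squeeze Sh-slices⊆Sh-G Sh-G≤Sh-slices S (reflects-complete (Sh-reflects G S) sh)))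

  common≤shared : card (F₀ ∩F F₁) ≤ shared
  common≤shared = ≤-trans (pajor (F₀ ∩F F₁)) (card-mono λ S S∈ →
    Equivalence.from (∈∩F (Sh F₀) (Sh F₁) S)
      (Sh-mono (∩F⊆ˡ F₀ F₁) S S∈ , Sh-mono (∩F⊆ʳ F₀ F₁) S S∈))

  -- |G| + |F₀ ∩ F₁| = |F₀| + |F₁| = |Sh G| + shared, and both summands are bounded.
  projection-tight : card G ≡ card (Sh G) × card (F₀ ∩F F₁) ≡ shared
  projection-tight = +-tight (pajor G) common≤shared
    (≤-reflexive (trans Sh-split (sym (card-∪∩ F₀ F₁))))

-- Induction on n through
-- the first point; the only non-inductive case is a set containing the first
-- point that would miss a trace in each slice, excluded by
-- 'not-missing-in-both-slices'.

-- If 'inside ∷ S' is minimal, its proper subset 'outside ∷ S' is shattered,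
-- so the projection G shatters S, hence so does one slice; that slice has no
-- missing trace on S.
not-missing-in-both-slices : ∀ {n} (F : Family (suc n)) → sExtremal F → ∀ {S U₀ U₁} →
  Minimal F (inside ∷ S) → Missing F (inside ∷ S) (outside ∷ U₀) →
  Missing F (inside ∷ S) (inside ∷ U₁) → ⊥
not-missing-in-both-slices F ext min miss₀ miss₁ =
  [ no-missing outside miss₀ , no-missing inside miss₁ ]′
    (projection-shatters (Equivalence.to shatters-outside (min (out⊂in ⊆-refl))))
  where
  open FirstPoint F
  open ExtremalSlices (extremal-slices F ext)
  no-missing : ∀ b {S U} → Missing F (inside ∷ S) (b ∷ U) → ¬ Shatters (slice b F) S
  no-missing b miss sh = let (U⊆S , ¬occ) = missing-inside b miss in ¬occ (sh _ U⊆S)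

missing-unique : ∀ {n} (F : Family n) → sExtremal F → ∀ {S T₁ T₂} →
                 Minimal F S → Missing F S T₁ → Missing F S T₂ → T₁ ≡ T₂
missing-unique F ext {[]} {[]} {[]} _ _ _ = refl
missing-unique F ext {outside ∷ S} {t₁ ∷ U₁} {t₂ ∷ U₂} min miss₁ miss₂
  with refl ← ⊆outside-head (proj₁ miss₁) | refl ← ⊆outside-head (proj₁ miss₂) =
  cong (outside ∷_) (missing-unique G projection-extremal
                       (minimal-outside min) (missing-outside miss₁) (missing-outside miss₂))
  where
  open FirstPoint F
  open ExtremalSlices (extremal-slices F ext)
missing-unique F ext {inside ∷ S} {b₁ ∷ _} {b₂ ∷ _} min miss₁ miss₂ = by-heads b₁ b₂ miss₁ miss₂
  where
  open FirstPoint F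
  open ExtremalSlices (extremal-slices F ext)

  same-slice : ∀ b {U₁ U₂} → Missing F (inside ∷ S) (b ∷ U₁) → Missing F (inside ∷ S) (b ∷ U₂) →
               b ∷ U₁ ≡ b ∷ U₂
  same-slice b m₁ m₂ = cong (b ∷_) (missing-unique (slice b F) (slice-extremal b)
                         (minimal-inside min b) (missing-inside b m₁) (missing-inside b m₂))

  by-heads : ∀ b₁ b₂ {U₁ U₂} → Missing F (inside ∷ S) (b₁ ∷ U₁) → Missing F (inside ∷ S) (b₂ ∷ U₂) →
             b₁ ∷ U₁ ≡ b₂ ∷ U₂
  by-heads outside outside       = same-slice outside
  by-heads inside  inside        = same-slice inside
  by-heads outside inside  m₁ m₂ = ⊥-elim (not-missing-in-both-slices F ext min m₁ m₂)
  by-heads inside  outside m₁ m₂ = ⊥-elim (not-missing-in-both-slices F ext min m₂ m₁)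

module Canonical {n} (F : Family n) where

  Critical : Subset n → Set
  Critical S = ¬ Shatters F S × Minimal F S

  unshattered-below? : ∀ S → Dec (∃ λ R → R ⊂ S × ¬ Shatters F R)
  unshattered-below? S = anySubset? λ R → R ⊂? S ×-dec ¬? (shatters? F R)

  nothing-below⇒minimal : ∀ {S} → ¬ (∃ λ R → R ⊂ S × ¬ Shatters F R) → Minimal F S
  nothing-below⇒minimal none R⊂S = decidable-stable (shatters? F _) λ ¬sh → none (_ , R⊂S , ¬sh)

  critical? : ∀ S → Dec (Critical S)
  critical? S = ¬? (shatters? F S) ×-dec
    map′ nothing-below⇒minimal (λ min (R , R⊂S , ¬sh) → ¬sh (min R⊂S)) (¬? (unshattered-below? S))

  𝒮₀ : Family n
  𝒮₀ S = does (critical? S)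

  critical : ∀ {S} → S ∈F 𝒮₀ → Critical S
  critical {S} = reflects-sound (proof (critical? S))

  critical⇒∈𝒮₀ : ∀ {S} → Critical S → S ∈F 𝒮₀
  critical⇒∈𝒮₀ {S} = reflects-complete (proof (critical? S))

  critical-below : ∀ {S} → ¬ Shatters F S → InUnionP 𝒮₀ S
  critical-below = descend (⊂-wellFounded _)
    where
    descend : ∀ {S} → Acc _⊂_ S → ¬ Shatters F S → InUnionP 𝒮₀ S
    descend {S} (acc smaller) ¬sh with unshattered-below? S
    ... | yes (R , R⊂S , ¬shR) =
      let (C , C∈𝒮₀ , C⊆R) = descend (smaller R⊂S) ¬shR in C , C∈𝒮₀ , ⊆-trans C⊆R (proj₁ R⊂S)
    ... | no none = S , critical⇒∈𝒮₀ (¬sh , nothing-below⇒minimal none) , ⊆-refl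

  h₀ : Subset n → Subset n
  h₀ S with anySubset? (λ T → T ⊆? S ×-dec ¬? (occurs? F S T))
  ... | yes (T , _) = T
  ... | no  _       = S

  h₀-missing : ∀ {S} → ¬ Shatters F S → Missing F S (h₀ S)
  h₀-missing {S} ¬sh with anySubset? (λ T → T ⊆? S ×-dec ¬? (occurs? F S T))
  ... | yes (_ , miss) = miss
  ... | no  none       =
    ⊥-elim (¬sh λ T T⊆S → decidable-stable (occurs? F S T) λ ¬occ → none (T , T⊆S , ¬occ))

  𝒮₀-sperner : Sperner 𝒮₀
  𝒮₀-sperner A B A∈𝒮₀ B∈𝒮₀ =
    unshattered⊆minimal (proj₂ (critical B∈𝒮₀)) (proj₁ (critical A∈𝒮₀))

  h₀⊆ : ∀ S → S ∈F 𝒮₀ → h₀ S ⊆ S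
  h₀⊆ S S∈𝒮₀ = proj₁ (h₀-missing (proj₁ (critical S∈𝒮₀)))

  -- F shatters A iff A contains no critical set: shattering is inherited by
  -- subsets, and below a non-shattered set lies a critical one.
  Sh≐𝓗 : Sh F ≐ 𝓗 𝒮₀
  Sh≐𝓗 A = reflects-equal (Sh-reflects F A) (𝓗-reflects 𝒮₀ A)
    (λ sh (C , C∈𝒮₀ , C⊆A) → proj₁ (critical C∈𝒮₀) (shatters-down C⊆A sh))
    (λ none → decidable-stable (shatters? F A) λ ¬sh → none (critical-below ¬sh))

  F⊆𝓕 : F ⊆F 𝓕 𝒮₀ h₀
  F⊆𝓕 A A∈F = reflects-complete (𝓕-reflects 𝒮₀ h₀ A) λ (S , S∈𝒮₀ , A∩S≡h₀S) →
    proj₂ (h₀-missing (proj₁ (critical S∈𝒮₀))) (A , A∈F , A∩S≡h₀S)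

  -- 𝓕 𝒮₀ h₀ shatters only sets shattered by F: below a set not shattered by F
  -- lies a critical C, and 𝓕 𝒮₀ h₀ misses the trace h₀ C on C.
  Sh𝓕⊆ShF : Sh (𝓕 𝒮₀ h₀) ⊆F Sh F
  Sh𝓕⊆ShF S S∈Sh𝓕 =
    reflects-complete (Sh-reflects F S) (decidable-stable (shatters? F S) λ ¬sh →
    let (C , C∈𝒮₀ , C⊆S) = critical-below ¬sh
        sh𝓕 = shatters-down C⊆S (reflects-sound (Sh-reflects (𝓕 𝒮₀ h₀) S) S∈Sh𝓕)
        (A , A∈𝓕 , A∩C≡h₀C) = sh𝓕 (h₀ C) (h₀⊆ C C∈𝒮₀)
    in reflects-sound (𝓕-reflects 𝒮₀ h₀ A) A∈𝓕 (C , C∈𝒮₀ , A∩C≡h₀C))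

  F≐𝓕 : sExtremal F → F ≐ 𝓕 𝒮₀ h₀
  F≐𝓕 ext = ⊆F-antisym F⊆𝓕 (card-squeeze F⊆𝓕 (begin
    card (𝓕 𝒮₀ h₀)       ≤⟨ pajor (𝓕 𝒮₀ h₀) ⟩
    card (Sh (𝓕 𝒮₀ h₀))  ≤⟨ card-mono Sh𝓕⊆ShF ⟩
    card (Sh F)           ≡⟨ ext ⟩
    card F                ∎))
    where open ≤-Reasoning

  represents : sExtremal F → Represents F 𝒮₀ h₀
  represents ext = 𝒮₀-sperner , h₀⊆ , F≐𝓕 ext , Sh≐𝓗

-- Any representation (𝒮, h) of an s-extremal F is the canonical one:
-- 𝓗 𝒮 = Sh F forces 𝒮 to be the family of critical sets, and 𝓕 𝒮 h = F
-- makes h S a missing trace of S, which is unique by 'missing-unique'.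

module Uniqueness {n} {F : Family n} (ext : sExtremal F) {𝒮 h} (rep : Represents F 𝒮 h) where
  open Canonical F

  private
    sperner : Sperner 𝒮
    sperner = proj₁ rep
    h⊆ : ∀ S → S ∈F 𝒮 → h S ⊆ S
    h⊆ = proj₁ (proj₂ rep)
    F≐𝓕𝒮h : F ≐ 𝓕 𝒮 h
    F≐𝓕𝒮h = proj₁ (proj₂ (proj₂ rep))
    Sh≐𝓗𝒮 : Sh F ≐ 𝓗 𝒮
    Sh≐𝓗𝒮 = proj₂ (proj₂ (proj₂ rep))

  shatters⇔ : ∀ A → Shatters F A ⇔ (¬ InUnionP 𝒮 A)
  shatters⇔ A =
    reflects-⇔ (Sh-reflects F A) (subst (Reflects _) (sym (Sh≐𝓗𝒮 A)) (𝓗-reflects 𝒮 A))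

  member-unshattered : ∀ {S} → S ∈F 𝒮 → ¬ Shatters F S
  member-unshattered {S} S∈𝒮 sh = Equivalence.to (shatters⇔ S) sh (S , S∈𝒮 , ⊆-refl)

  -- A proper subset R ⊂ S of a member is shattered: a member S′ ⊆ R would
  -- equal S by the Sperner property, contradicting R ⊂ S.
  member-minimal : ∀ {S} → S ∈F 𝒮 → Minimal F S
  member-minimal {S} S∈𝒮 {R} R⊂S = Equivalence.from (shatters⇔ R) λ (S′ , S′∈𝒮 , S′⊆R) →
    let S′≡S = sperner S′ S S′∈𝒮 S∈𝒮 (⊆-trans S′⊆R (proj₁ R⊂S))
    in ⊂-irref refl (⊂-⊆-trans R⊂S (subst (_⊆ R) S′≡S S′⊆R))

  -- A critical S is not shattered, so it contains a member S′ of 𝒮; S′ is not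
  -- shattered, so by minimality of S it is S itself.
  critical-member : ∀ {S} → S ∈F 𝒮₀ → S ∈F 𝒮
  critical-member {S} S∈𝒮₀ =
    let (¬sh , min) = critical S∈𝒮₀
        (S′ , S′∈𝒮 , S′⊆S) =
          decidable-stable (inUnionP? 𝒮 S) (¬sh ∘ Equivalence.from (shatters⇔ S))
    in subst (_∈F 𝒮) (unshattered⊆minimal min (member-unshattered S′∈𝒮) S′⊆S) S′∈𝒮

  𝒮≐𝒮₀ : 𝒮 ≐ 𝒮₀
  𝒮≐𝒮₀ = ⊆F-antisym (λ S S∈𝒮 → critical⇒∈𝒮₀ (member-unshattered S∈𝒮 , member-minimal S∈𝒮))
                     (λ S → critical-member)

  -- h S is a missing trace: a member A of F with A ∩ S = h S would lie in
  -- Q_{S,h(S)}, outside 𝓕 𝒮 h = F.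
  h-missing : ∀ {S} → S ∈F 𝒮 → Missing F S (h S)
  h-missing {S} S∈𝒮 = h⊆ S S∈𝒮 , λ (A , A∈F , A∩S≡hS) →
    reflects-sound (𝓕-reflects 𝒮 h A) (trans (sym (F≐𝓕𝒮h A)) A∈F) (S , S∈𝒮 , A∩S≡hS)

  h≡h₀ : ∀ S → S ∈F 𝒮₀ → h S ≡ h₀ S
  h≡h₀ S S∈𝒮₀ = missing-unique F ext (proj₂ (critical S∈𝒮₀))
                  (h-missing (critical-member S∈𝒮₀)) (h₀-missing (proj₁ (critical S∈𝒮₀)))

lemma8 : (n : ℕ) (F : Family n) → sExtremal F →
    Σ (Family n) (λ 𝒮 → Σ (Subset n → Subset n) (λ h →
      Represents F 𝒮 h ×
      ((𝒮′ : Family n) (h′ : Subset n → Subset n) → Represents F 𝒮′ h′ →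
        (𝒮′ ≐ 𝒮) × (∀ S → S ∈F 𝒮 → h′ S ≡ h S))))
lemma8 n F ext = 𝒮₀ , h₀ , represents ext ,
  λ 𝒮′ h′ rep → Uniqueness.𝒮≐𝒮₀ ext rep , Uniqueness.h≡h₀ ext rep
  where open Canonical F
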